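{- There is an absolute constant $C>0$ such that for all positive integers $n$ and $k\ge1$ and every integer $s$ with $0\le\lfloor n/2\rfloor+s\le n$, \[ \left|\mathcal{K}(n,\lfloor n/2\rfloor+s,k)\right|\le C^k\left(\left(\frac{n}{k}\right)^{k/2}+\left(\frac{|s|}{k}\right)^k\right). \]
   Context: For $0\le w,k\le n$, $\mathcal{K}(n,w,k):=\sum_{x\in\{0,1\}^n,\,|x|=k}(-1)^{x_1+\cdots+x_w}$ (the Kravchuk polynomial), where $|x|$ is the Hamming weight of $x$. -}

module Defs where

open import Data.Bool using (Bool; true; false; _∧_; if_then_else_)
open import Data.Nat using (ℕ; zero; suc; _<ᵇ_; _≡ᵇ_)
open import Data.Integer using (ℤ; +_; -_; _*_; _+_)
open import Data.Fin using (Fin; toℕ)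
open import Data.Vec using (Vec; []; _∷_; lookup)
open import Data.List using (List; []; _∷_; map; filter; foldr; allFin; _++_)
open import Relation.Nullary.Decidable using (Dec; yes; no)
open import Relation.Binary.PropositionalEquality using (_≡_)
open import Data.Bool.Properties using (T?)

allVecs : (n : ℕ) → List (Vec Bool n)
allVecs zero = [] ∷ []
allVecs (suc n) = map (false ∷_) (allVecs n) ++ map (true ∷_) (allVecs n)

weight : {n : ℕ} → Vec Bool n → ℕ
weight [] = 0
weight (true ∷ xs) = suc (weight xs)
weight (false ∷ xs) = weight xs

-- (-1)^{x_1 + ... + x_w}  (coordinates indexed 1..n; x_i with i ≤ w, i.e. Fin index < w)
signW : {n : ℕ} → ℕ → Vec Bool n → ℤ
signW {n} w x = foldr _*_ (+ 1) (map (λ i → if (toℕ i <ᵇ w) ∧ lookup x i then - (+ 1) else + 1) (allFin n))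

kravchuk : ℕ → ℕ → ℕ → ℤ
kravchuk n w k = foldr _+_ (+ 0) (map (signW w) (filter (λ x → T? (weight x ≡ᵇ k)) (allVecs n)))

-- Writing w = ⌊n/2⌋ + s, the number K(n,w,k) is the coefficient of z^k in
-- (1 - z)^w (1 + z)^(n - w) = (1 - z²)^a (1 ± z)^e, where a = min(w, n - w) and e = |n - 2w| ≤ 1 + 2|s|.
-- Hence |K(n,w,k)| is at most the coefficient of z^k in (1 + z²)^a (1 + z)^e, which is at most
-- (1 + x²)^a (1 + x)^e / x^k for every x > 0. Take x = k/q with q = max(e, √(nk), 4k). As 2a ≤ n and
-- (1 + y)^m ≤ 2^j whenever y ≤ 1/4 and 4my ≤ j, this is at most 4096^k (q/k)^k. If q = e this is the
-- term (|s|/k)^k; otherwise q² = O(nk), which gives the term (n/k)^(k/2).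
module Submission where

open import Defs
open import Data.Nat using (ℕ; _≤_; _<_; _*_; _^_; _∸_; _+_; _/_)
open import Data.Integer using (ℤ; +_; ∣_∣) renaming (_+_ to _+ℤ_; _≤_ to _≤ℤ_)
open import Data.Product using (∃; _×_)

open import Data.Bool using (Bool; true; false; if_then_else_; _∧_)
open import Data.Bool.Properties using (T?)
open import Data.Fin using (Fin; toℕ)
import Data.Fin as Fin
open import Data.Integer using (_⊖_)
import Data.Integer as ℤ
import Data.Integer.Properties as ℤ
open import Data.Integer.Tactic.RingSolver renaming (solve-∀ to ℤ-solve-∀)
open import Data.List using (List; []; _∷_; map; filter; foldr; _++_; tabulate)
open import Data.List.Properties using (filter-++; filter-none; map-++; map-∘; map-cong; map-tabulate)
import Data.List.Relation.Unary.All as All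
open import Data.Nat using (zero; suc; pred; _≡ᵇ_; _<ᵇ_; _⊓_; _⊔_; z≤n; s≤s; s≤s⁻¹; s<s⁻¹; >-nonZero)
open import Data.Nat.Combinatorics using (_C_; nCk+nC[k+1]≡[n+1]C[k+1]; k>n⇒nCk≡0)
open import Data.Nat.DivMod using (m≡m%n+[m/n]*n; m%n<n; m/n*n≤m)
import Data.Nat.Properties as ℕ
open import Data.Nat.Tactic.RingSolver renaming (solve-∀ to ℕ-solve-∀)
open import Data.Product using (∃₂; _,_)
open import Data.Sum using (_⊎_; inj₁; inj₂)
open import Data.Vec using (Vec; []; _∷_; lookup)
open import Function using (_∘_)
open import Relation.Binary.PropositionalEquality
open import Relation.Nullary using (does; yes; no)
open import Relation.Unary using (Pred; Decidable)

sumℤ : List ℤ → ℤ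
sumℤ = foldr ℤ._+_ (+ 0)

sumℤ-++ : ∀ xs ys → sumℤ (xs ++ ys) ≡ sumℤ xs ℤ.+ sumℤ ys
sumℤ-++ []       ys = sym (ℤ.+-identityˡ _)
sumℤ-++ (x ∷ xs) ys = trans (cong (ℤ._+_ x) (sumℤ-++ xs ys)) (sym (ℤ.+-assoc x _ _))

sumℤ-scale : ∀ c xs → sumℤ (map (c ℤ.*_) xs) ≡ c ℤ.* sumℤ xs
sumℤ-scale c []       = sym (ℤ.*-zeroʳ c)
sumℤ-scale c (x ∷ xs) = trans (cong (ℤ._+_ (c ℤ.* x)) (sumℤ-scale c xs)) (sym (ℤ.*-distribˡ-+ c x _))

filter-map : ∀ {a p} {A B : Set a} {P : Pred B p} (P? : Decidable P) (f : A → B) xs →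
             filter P? (map f xs) ≡ map f (filter (P? ∘ f) xs)
filter-map P? f []       = refl
filter-map P? f (x ∷ xs) with does (P? (f x))
... | true  = cong (f x ∷_) (filter-map P? f xs)
... | false = filter-map P? f xs

weightSum : ∀ n → ℕ → (Vec Bool n → ℤ) → ℤ
weightSum n k F = sumℤ (map F (filter (λ x → T? (weight x ≡ᵇ k)) (allVecs n)))

weightSum-cong : ∀ n k {F G : Vec Bool n → ℤ} → F ≗ G → weightSum n k F ≡ weightSum n k G
weightSum-cong n k F≗G = cong sumℤ (map-cong F≗G (filter (λ x → T? (weight x ≡ᵇ k)) (allVecs n)))

weightSum-scale : ∀ n k c (F : Vec Bool n → ℤ) →
                  weightSum n k (λ x → c ℤ.* F x) ≡ c ℤ.* weightSum n k F
weightSum-scale n k c F = begin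
  sumℤ (map ((c ℤ.*_) ∘ F) xs)  ≡⟨ cong sumℤ (map-∘ xs) ⟩
  sumℤ (map (c ℤ.*_) (map F xs)) ≡⟨ sumℤ-scale c (map F xs) ⟩
  c ℤ.* sumℤ (map F xs)         ∎
  where
    open ≡-Reasoning
    xs = filter (λ x → T? (weight x ≡ᵇ k)) (allVecs n)

weightSum-∷ : ∀ {n} k (F : Vec Bool (suc n) → ℤ) → weightSum (suc n) k F ≡
  weightSum n k (F ∘ (false ∷_)) ℤ.+ sumℤ (map (F ∘ (true ∷_)) (filter (λ x → T? (suc (weight x) ≡ᵇ k)) (allVecs n)))
weightSum-∷ {n} k F = begin
  sumℤ (map F (filter P? (map (false ∷_) xs ++ map (true ∷_) xs)))
    ≡⟨ cong (sumℤ ∘ map F) (filter-++ P? (map (false ∷_) xs) (map (true ∷_) xs)) ⟩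
  sumℤ (map F (filter P? (map (false ∷_) xs) ++ filter P? (map (true ∷_) xs)))
    ≡⟨ cong sumℤ (map-++ F (filter P? (map (false ∷_) xs)) _) ⟩
  sumℤ (map F (filter P? (map (false ∷_) xs)) ++ map F (filter P? (map (true ∷_) xs)))
    ≡⟨ sumℤ-++ (map F (filter P? (map (false ∷_) xs))) _ ⟩
  sumℤ (map F (filter P? (map (false ∷_) xs))) ℤ.+ sumℤ (map F (filter P? (map (true ∷_) xs)))
    ≡⟨ cong₂ ℤ._+_ (restrict false) (restrict true) ⟩
  _ ∎
  where
    open ≡-Reasoning
    xs = allVecs n
    P? : (x : Vec Bool (suc n)) → _
    P? x = T? (weight x ≡ᵇ k)
    restrict : ∀ b → sumℤ (map F (filter P? (map (b ∷_) xs))) ≡ sumℤ (map (F ∘ (b ∷_)) (filter (P? ∘ (b ∷_)) xs))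
    restrict b = cong sumℤ (trans (cong (map F) (filter-map P? (b ∷_) xs)) (sym (map-∘ _)))

weightSum-∷-suc : ∀ {n} k (F : Vec Bool (suc n) → ℤ) →
  weightSum (suc n) (suc k) F ≡ weightSum n (suc k) (F ∘ (false ∷_)) ℤ.+ weightSum n k (F ∘ (true ∷_))
weightSum-∷-suc k F = weightSum-∷ (suc k) F

weightSum-∷-zero : ∀ {n} (F : Vec Bool (suc n) → ℤ) → weightSum (suc n) 0 F ≡ weightSum n 0 (F ∘ (false ∷_))
weightSum-∷-zero {n} F = begin
  weightSum (suc n) 0 F                                     ≡⟨ weightSum-∷ 0 F ⟩
  weightSum n 0 (F ∘ (false ∷_)) ℤ.+ sumℤ (map (F ∘ (true ∷_)) (filter P? (allVecs n)))
    ≡⟨ cong (λ xs → weightSum n 0 (F ∘ (false ∷_)) ℤ.+ sumℤ (map (F ∘ (true ∷_)) xs)) nothing-selected ⟩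
  weightSum n 0 (F ∘ (false ∷_)) ℤ.+ + 0                    ≡⟨ ℤ.+-identityʳ _ ⟩
  weightSum n 0 (F ∘ (false ∷_))                            ∎
  where
    open ≡-Reasoning
    P? : (x : Vec Bool n) → _
    P? x = T? (suc (weight x) ≡ᵇ 0)
    nothing-selected : filter P? (allVecs n) ≡ []
    nothing-selected = filter-none P? (All.universal (λ _ ()) (allVecs n))

weightSum-1≡C : ∀ n k → weightSum n k (λ _ → + 1) ≡ + (n C k)
weightSum-1≡C zero    zero    = refl
weightSum-1≡C zero    (suc k) = refl
weightSum-1≡C (suc n) zero    = trans (weightSum-∷-zero {n} (λ _ → + 1)) (weightSum-1≡C n zero)
weightSum-1≡C (suc n) (suc k) = begin
  weightSum (suc n) (suc k) (λ _ → + 1)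
    ≡⟨ weightSum-∷-suc {n} k (λ _ → + 1) ⟩
  weightSum n (suc k) (λ _ → + 1) ℤ.+ weightSum n k (λ _ → + 1)
    ≡⟨ cong₂ ℤ._+_ (weightSum-1≡C n (suc k)) (weightSum-1≡C n k) ⟩
  + (n C suc k) ℤ.+ + (n C k)
    ≡⟨ sym (ℤ.pos-+ (n C suc k) (n C k)) ⟩
  + (n C suc k + n C k)
    ≡⟨ cong +_ (trans (ℕ.+-comm (n C suc k) (n C k)) (nCk+nC[k+1]≡[n+1]C[k+1] n k)) ⟩
  + (suc n C suc k) ∎
  where open ≡-Reasoning

signOf : Bool → ℤ
signOf b = if b then ℤ.- + 1 else + 1

coordinateSign : ∀ {n} → ℕ → Vec Bool n → Fin n → ℤ
coordinateSign w x i = if (toℕ i <ᵇ w) ∧ lookup x i then ℤ.- (+ 1) else + 1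

signW-tail : ∀ {n} w b (x : Vec Bool n) →
  foldr ℤ._*_ (+ 1) (map (coordinateSign w (b ∷ x)) (tabulate Fin.suc)) ≡ signW (pred w) x
signW-tail {n} zero    b x = cong (foldr ℤ._*_ (+ 1))
  (trans (map-tabulate Fin.suc (coordinateSign 0 (b ∷ x))) (sym (map-tabulate (λ i → i) (coordinateSign 0 x))))
signW-tail {n} (suc w) b x = cong (foldr ℤ._*_ (+ 1))
  (trans (map-tabulate Fin.suc (coordinateSign (suc w) (b ∷ x))) (sym (map-tabulate (λ i → i) (coordinateSign w x))))

signW-∷ : ∀ {n} w b (x : Vec Bool n) → signW (suc w) (b ∷ x) ≡ signOf b ℤ.* signW w x
signW-∷ w b x = cong (ℤ._*_ (signOf b)) (signW-tail (suc w) b x)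

signW-zero : ∀ {n} (x : Vec Bool n) → signW 0 x ≡ + 1
signW-zero []      = refl
signW-zero (b ∷ x) = trans (ℤ.*-identityˡ _) (trans (signW-tail 0 b x) (signW-zero x))

kravchuk[n,0,k]≡nCk : ∀ n k → kravchuk n 0 k ≡ + (n C k)
kravchuk[n,0,k]≡nCk n k = trans (weightSum-cong n k signW-zero) (weightSum-1≡C n k)

kravchuk-suc-zero : ∀ n w → kravchuk (suc n) (suc w) 0 ≡ kravchuk n w 0
kravchuk-suc-zero n w = begin
  kravchuk (suc n) (suc w) 0                           ≡⟨ weightSum-∷-zero {n} (signW (suc w)) ⟩
  weightSum n 0 (λ x → signW (suc w) (false ∷ x))    ≡⟨ weightSum-cong n 0 (signW-∷ w false) ⟩
  weightSum n 0 (λ x → + 1 ℤ.* signW w x)            ≡⟨ weightSum-scale n 0 (+ 1) (signW w) ⟩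
  + 1 ℤ.* kravchuk n w 0                               ≡⟨ ℤ.*-identityˡ _ ⟩
  kravchuk n w 0                                       ∎
  where open ≡-Reasoning

kravchuk-suc-suc : ∀ n w k → kravchuk (suc n) (suc w) (suc k) ≡ kravchuk n w (suc k) ℤ.- kravchuk n w k
kravchuk-suc-suc n w k = begin
  kravchuk (suc n) (suc w) (suc k)
    ≡⟨ weightSum-∷-suc {n} k (signW (suc w)) ⟩
  weightSum n (suc k) (λ x → signW (suc w) (false ∷ x)) ℤ.+ weightSum n k (λ x → signW (suc w) (true ∷ x))
    ≡⟨ cong₂ ℤ._+_ (weightSum-cong n (suc k) (signW-∷ w false)) (weightSum-cong n k (signW-∷ w true)) ⟩
  weightSum n (suc k) (λ x → + 1 ℤ.* signW w x) ℤ.+ weightSum n k (λ x → ℤ.- + 1 ℤ.* signW w x)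
    ≡⟨ cong₂ ℤ._+_ (weightSum-scale n (suc k) (+ 1) (signW w)) (weightSum-scale n k (ℤ.- + 1) (signW w)) ⟩
  + 1 ℤ.* kravchuk n w (suc k) ℤ.+ ℤ.- + 1 ℤ.* kravchuk n w k
    ≡⟨ unit-coefficients (kravchuk n w (suc k)) (kravchuk n w k) ⟩
  kravchuk n w (suc k) ℤ.- kravchuk n w k ∎
  where
    open ≡-Reasoning
    unit-coefficients : ∀ a b → + 1 ℤ.* a ℤ.+ ℤ.- + 1 ℤ.* b ≡ a ℤ.- b
    unit-coefficients = ℤ-solve-∀

-- Generating functions

-- A power series is represented by its coefficient sequence ℕ → ℤ.
oneMinusZ : (ℕ → ℤ) → ℕ → ℤ
oneMinusZ f zero    = f zero
oneMinusZ f (suc k) = f (suc k) ℤ.- f k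

timesZ² : (ℕ → ℤ) → ℕ → ℤ
timesZ² f zero          = + 0
timesZ² f (suc zero)    = + 0
timesZ² f (suc (suc k)) = f k

-- The coefficient of z^k in (1 - z)^w (1 + z)^u.
kravchukCoeff : ℕ → ℕ → ℕ → ℤ
kravchukCoeff zero    u k = + (u C k)
kravchukCoeff (suc w) u   = oneMinusZ (kravchukCoeff w u)

kravchuk≡kravchukCoeff : ∀ {n w} k → w ≤ n → kravchuk n w k ≡ kravchukCoeff w (n ∸ w) k
kravchuk≡kravchukCoeff {n}     {zero}  k       z≤n       = kravchuk[n,0,k]≡nCk n k
kravchuk≡kravchukCoeff {suc n} {suc w} zero    (s≤s w≤n) =
  trans (kravchuk-suc-zero n w) (kravchuk≡kravchukCoeff zero w≤n)
kravchuk≡kravchukCoeff {suc n} {suc w} (suc k) (s≤s w≤n) =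
  trans (kravchuk-suc-suc n w k) (cong₂ ℤ._-_ (kravchuk≡kravchukCoeff (suc k) w≤n) (kravchuk≡kravchukCoeff k w≤n))

oneMinusZ-timesZ² : ∀ f k → oneMinusZ (timesZ² f) k ≡ timesZ² (oneMinusZ f) k
oneMinusZ-timesZ² f zero                = refl
oneMinusZ-timesZ² f (suc zero)          = refl
oneMinusZ-timesZ² f (suc (suc zero))    = ℤ.+-identityʳ (f zero)
oneMinusZ-timesZ² f (suc (suc (suc k))) = refl

pascalℤ : ∀ u k → + (suc u C suc k) ≡ + (u C k) ℤ.+ + (u C suc k)
pascalℤ u k = trans (cong +_ (sym (nCk+nC[k+1]≡[n+1]C[k+1] u k))) (ℤ.pos-+ (u C k) (u C suc k))

-- (1 - z)(1 + z) = 1 - z²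
kravchukCoeff-suc-suc : ∀ w u k →
  kravchukCoeff (suc w) (suc u) k ≡ kravchukCoeff w u k ℤ.- timesZ² (kravchukCoeff w u) k
kravchukCoeff-suc-suc zero u zero = refl
kravchukCoeff-suc-suc zero u (suc zero) = begin
  + (suc u C 1) ℤ.- + 1               ≡⟨ cong (ℤ._+ ℤ.- + 1) (pascalℤ u 0) ⟩
  + 1 ℤ.+ + (u C 1) ℤ.- + 1           ≡⟨ cancel (+ (u C 1)) ⟩
  + (u C 1) ℤ.- + 0                    ∎
  where
    open ≡-Reasoning
    cancel : ∀ a → + 1 ℤ.+ a ℤ.- + 1 ≡ a ℤ.- + 0
    cancel = ℤ-solve-∀
kravchukCoeff-suc-suc zero u (suc (suc k)) = begin
  + (suc u C suc (suc k)) ℤ.- + (suc u C suc k)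
    ≡⟨ cong₂ ℤ._-_ (pascalℤ u (suc k)) (pascalℤ u k) ⟩
  (+ (u C suc k) ℤ.+ + (u C suc (suc k))) ℤ.- (+ (u C k) ℤ.+ + (u C suc k))
    ≡⟨ cancel (+ (u C k)) (+ (u C suc k)) (+ (u C suc (suc k))) ⟩
  + (u C suc (suc k)) ℤ.- + (u C k)    ∎
  where
    open ≡-Reasoning
    cancel : ∀ a b c → (b ℤ.+ c) ℤ.- (a ℤ.+ b) ≡ c ℤ.- a
    cancel = ℤ-solve-∀
kravchukCoeff-suc-suc (suc w) u zero = kravchukCoeff-suc-suc w u zero
kravchukCoeff-suc-suc (suc w) u (suc k) = begin
  P (suc w) (suc u) (suc k) ℤ.- P (suc w) (suc u) k
    ≡⟨ cong₂ ℤ._-_ (kravchukCoeff-suc-suc w u (suc k)) (kravchukCoeff-suc-suc w u k) ⟩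
  (P w u (suc k) ℤ.- timesZ² (P w u) (suc k)) ℤ.- (P w u k ℤ.- timesZ² (P w u) k)
    ≡⟨ regroup (P w u (suc k)) (timesZ² (P w u) (suc k)) (P w u k) (timesZ² (P w u) k) ⟩
  oneMinusZ (P w u) (suc k) ℤ.- oneMinusZ (timesZ² (P w u)) (suc k)
    ≡⟨ cong (ℤ._-_ (oneMinusZ (P w u) (suc k))) (oneMinusZ-timesZ² (P w u) (suc k)) ⟩
  P (suc w) u (suc k) ℤ.- timesZ² (P (suc w) u) (suc k) ∎
  where
    open ≡-Reasoning
    P = kravchukCoeff
    regroup : ∀ a b c d → (a ℤ.- b) ℤ.- (c ℤ.- d) ≡ (a ℤ.- c) ℤ.- (b ℤ.- d)
    regroup = ℤ-solve-∀

-- The coefficient of z^k in (1 + z²)^a (1 + z)^d.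
majorant : ℕ → ℕ → ℕ → ℕ
majorant zero    d k                   = d C k
majorant (suc a) d zero                = majorant a d zero
majorant (suc a) d (suc zero)          = majorant a d 1
majorant (suc a) d (suc (suc k))       = majorant a d (suc (suc k)) + majorant a d k

∣[1-z²]f∣≤majorant : ∀ a d (f : ℕ → ℤ) → (∀ j → ∣ f j ∣ ≤ majorant a d j) →
                     ∀ k → ∣ f k ℤ.- timesZ² f k ∣ ≤ majorant (suc a) d k
∣[1-z²]f∣≤majorant a d f ∣f∣≤ zero =
  ℕ.≤-trans (ℕ.≤-reflexive (cong ∣_∣ (ℤ.+-identityʳ (f 0)))) (∣f∣≤ 0)
∣[1-z²]f∣≤majorant a d f ∣f∣≤ (suc zero) =
  ℕ.≤-trans (ℕ.≤-reflexive (cong ∣_∣ (ℤ.+-identityʳ (f 1)))) (∣f∣≤ 1)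
∣[1-z²]f∣≤majorant a d f ∣f∣≤ (suc (suc k)) =
  ℕ.≤-trans (ℤ.∣i-j∣≤∣i∣+∣j∣ (f (suc (suc k))) (f k)) (ℕ.+-mono-≤ (∣f∣≤ (suc (suc k))) (∣f∣≤ k))

∣kravchukCoeff[w,0]∣≤wCk : ∀ w k → ∣ kravchukCoeff w 0 k ∣ ≤ w C k
∣kravchukCoeff[w,0]∣≤wCk zero    k       = ℕ.≤-refl
∣kravchukCoeff[w,0]∣≤wCk (suc w) zero    = ∣kravchukCoeff[w,0]∣≤wCk w zero
∣kravchukCoeff[w,0]∣≤wCk (suc w) (suc k) = begin
  ∣ kravchukCoeff w 0 (suc k) ℤ.- kravchukCoeff w 0 k ∣
    ≤⟨ ℤ.∣i-j∣≤∣i∣+∣j∣ (kravchukCoeff w 0 (suc k)) (kravchukCoeff w 0 k) ⟩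
  ∣ kravchukCoeff w 0 (suc k) ∣ + ∣ kravchukCoeff w 0 k ∣
    ≤⟨ ℕ.+-mono-≤ (∣kravchukCoeff[w,0]∣≤wCk w (suc k)) (∣kravchukCoeff[w,0]∣≤wCk w k) ⟩
  w C suc k + w C k
    ≡⟨ trans (ℕ.+-comm (w C suc k) (w C k)) (nCk+nC[k+1]≡[n+1]C[k+1] w k) ⟩
  suc w C suc k ∎
  where open ℕ.≤-Reasoning

∣kravchukCoeff[a+e,a]∣≤majorant : ∀ a e k → ∣ kravchukCoeff (a + e) a k ∣ ≤ majorant a e k
∣kravchukCoeff[a+e,a]∣≤majorant zero    e k = ∣kravchukCoeff[w,0]∣≤wCk e k
∣kravchukCoeff[a+e,a]∣≤majorant (suc a) e k =
  ℕ.≤-trans (ℕ.≤-reflexive (cong ∣_∣ (kravchukCoeff-suc-suc (a + e) a k)))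
            (∣[1-z²]f∣≤majorant a e (kravchukCoeff (a + e) a) (∣kravchukCoeff[a+e,a]∣≤majorant a e) k)

∣kravchukCoeff[a,a+e]∣≤majorant : ∀ a e k → ∣ kravchukCoeff a (a + e) k ∣ ≤ majorant a e k
∣kravchukCoeff[a,a+e]∣≤majorant zero    e k = ℕ.≤-refl
∣kravchukCoeff[a,a+e]∣≤majorant (suc a) e k =
  ℕ.≤-trans (ℕ.≤-reflexive (cong ∣_∣ (kravchukCoeff-suc-suc a (a + e) k)))
            (∣[1-z²]f∣≤majorant a e (kravchukCoeff a (a + e)) (∣kravchukCoeff[a,a+e]∣≤majorant a e) k)

∣m-[m+n]∣≡n : ∀ m n → ∣ + m ℤ.- + (m + n) ∣ ≡ n
∣m-[m+n]∣≡n m n = begin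
  ∣ + m ℤ.- + (m + n) ∣  ≡⟨ cong ∣_∣ (ℤ.m-n≡m⊖n m (m + n)) ⟩
  ∣ m ⊖ (m + n) ∣        ≡⟨ ℤ.∣⊖∣-≤ (ℕ.m≤m+n m n) ⟩
  m + n ∸ m              ≡⟨ ℕ.m+n∸m≡n m n ⟩
  n                      ∎
  where open ≡-Reasoning

∣kravchukCoeff∣≤majorant : ∀ w u k → ∃₂ λ a e →
  w + u ≡ a + a + e × ∣ + w ℤ.- + u ∣ ≡ e × ∣ kravchukCoeff w u k ∣ ≤ majorant a e k
∣kravchukCoeff∣≤majorant w u k with ℕ.≤-total w u
... | inj₁ w≤u with u ∸ w | ℕ.m+[n∸m]≡n w≤u
...   | e | refl = w , e , sym (ℕ.+-assoc w w e) , ∣m-[m+n]∣≡n w e , ∣kravchukCoeff[a,a+e]∣≤majorant w e k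
∣kravchukCoeff∣≤majorant w u k | inj₂ u≤w with w ∸ u | ℕ.m+[n∸m]≡n u≤w
...   | e | refl = u , e , trans (ℕ.+-assoc u e u) (trans (cong (_+_ u) (ℕ.+-comm e u)) (sym (ℕ.+-assoc u u e))) ,
                   trans (ℤ.∣i-j∣≡∣j-i∣ (+ (u + e)) (+ u)) (∣m-[m+n]∣≡n u e) , ∣kravchukCoeff[a+e,a]∣≤majorant u e k

binomial-evaluation : ∀ p q d k → (d C k) * p ^ k * q ^ d ≤ (q + p) ^ d * q ^ k
binomial-evaluation p q zero    zero    = ℕ.≤-refl
binomial-evaluation p q zero    (suc k) = z≤n
binomial-evaluation p q (suc d) zero    = begin
  1 * q ^ suc d          ≡⟨ ℕ.*-identityˡ (q ^ suc d) ⟩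
  q ^ suc d              ≤⟨ ℕ.^-monoˡ-≤ (suc d) (ℕ.m≤m+n q p) ⟩
  (q + p) ^ suc d        ≡⟨ ℕ.*-identityʳ ((q + p) ^ suc d) ⟨
  (q + p) ^ suc d * 1    ∎
  where open ℕ.≤-Reasoning
binomial-evaluation p q (suc d) (suc k) = begin
  (suc d C suc k) * (p * p ^ k) * (q * q ^ d)
    ≡⟨ cong (λ c → c * (p * p ^ k) * (q * q ^ d)) (nCk+nC[k+1]≡[n+1]C[k+1] d k) ⟨
  (d C k + d C suc k) * (p * p ^ k) * (q * q ^ d)
    ≡⟨ split (d C k) (d C suc k) p q (p ^ k) (q ^ d) ⟩
  p * q * ((d C k) * p ^ k * q ^ d) + q * ((d C suc k) * (p * p ^ k) * q ^ d)
    ≤⟨ ℕ.+-mono-≤ (ℕ.*-monoʳ-≤ (p * q) (binomial-evaluation p q d k))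
                  (ℕ.*-monoʳ-≤ q (binomial-evaluation p q d (suc k))) ⟩
  p * q * ((q + p) ^ d * q ^ k) + q * ((q + p) ^ d * (q * q ^ k))
    ≡⟨ merge p q ((q + p) ^ d) (q ^ k) ⟩
  (q + p) * (q + p) ^ d * (q * q ^ k) ∎
  where
    open ℕ.≤-Reasoning
    split : ∀ b c p q x y → (b + c) * (p * x) * (q * y) ≡ p * q * (b * x * y) + q * (c * (p * x) * y)
    split = ℕ-solve-∀
    merge : ∀ p q h y → p * q * (h * y) + q * (h * (q * y)) ≡ (q + p) * h * (q * y)
    merge = ℕ-solve-∀

majorant-evaluation : ∀ p q a d k →
  majorant a d k * p ^ k * q ^ (a + a + d) ≤ (q * q + p * p) ^ a * (q + p) ^ d * q ^ k
majorant-evaluation p q zero    d k = ℕ.≤-trans (binomial-evaluation p q d k)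
  (ℕ.≤-reflexive (cong (_* q ^ k) (sym (ℕ.*-identityˡ ((q + p) ^ d)))))
majorant-evaluation p q (suc a) d k =
  subst (λ t → majorant (suc a) d k * p ^ k * t ≤ (q * q + p * p) ^ suc a * (q + p) ^ d * q ^ k)
        (sym q^[2+E]) (step k)
  where
    open ℕ.≤-Reasoning
    E = a + a + d
    X = q * q + p * p
    H = X ^ a * (q + p) ^ d
    q^[2+E] : q ^ (suc a + suc a + d) ≡ q * q * q ^ E
    q^[2+E] = trans (cong (λ t → q ^ (suc t + d)) (ℕ.+-suc a a)) (sym (ℕ.*-assoc q q (q ^ E)))
    below-z² : ∀ k → majorant a d k * p ^ k * (q * q * q ^ E) ≤ X * X ^ a * (q + p) ^ d * q ^ k
    below-z² k = begin
      majorant a d k * p ^ k * (q * q * q ^ E)  ≡⟨ pull (majorant a d k * p ^ k) (q * q) (q ^ E) ⟩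
      q * q * (majorant a d k * p ^ k * q ^ E)  ≤⟨ ℕ.*-monoʳ-≤ (q * q) (majorant-evaluation p q a d k) ⟩
      q * q * (H * q ^ k)                        ≤⟨ ℕ.*-monoˡ-≤ (H * q ^ k) (ℕ.m≤m+n (q * q) (p * p)) ⟩
      X * (H * q ^ k)                            ≡⟨ reassoc X (X ^ a) ((q + p) ^ d) (q ^ k) ⟩
      X * X ^ a * (q + p) ^ d * q ^ k            ∎
      where
        pull : ∀ m s t → m * (s * t) ≡ s * (m * t)
        pull = ℕ-solve-∀
        reassoc : ∀ x y z w → x * (y * z * w) ≡ x * y * z * w
        reassoc = ℕ-solve-∀
    step : ∀ k → majorant (suc a) d k * p ^ k * (q * q * q ^ E) ≤ X * X ^ a * (q + p) ^ d * q ^ k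
    step zero          = below-z² zero
    step (suc zero)    = below-z² 1
    step (suc (suc j)) = begin
      (majorant a d (suc (suc j)) + majorant a d j) * (p * (p * p ^ j)) * (q * q * q ^ E)
        ≡⟨ split (majorant a d (suc (suc j))) (majorant a d j) p q (p ^ j) (q ^ E) ⟩
      q * q * (majorant a d (suc (suc j)) * (p * (p * p ^ j)) * q ^ E) + p * p * (q * q) * (majorant a d j * p ^ j * q ^ E)
        ≤⟨ ℕ.+-mono-≤ (ℕ.*-monoʳ-≤ (q * q) (majorant-evaluation p q a d (suc (suc j))))
                      (ℕ.*-monoʳ-≤ (p * p * (q * q)) (majorant-evaluation p q a d j)) ⟩
      q * q * (H * (q * (q * q ^ j))) + p * p * (q * q) * (H * q ^ j)
        ≡⟨ merge p q (X ^ a) ((q + p) ^ d) (q ^ j) ⟩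
      X * X ^ a * (q + p) ^ d * (q * (q * q ^ j)) ∎
      where
        split : ∀ m m′ p q x y → (m + m′) * (p * (p * x)) * (q * q * y)
                                ≡ q * q * (m * (p * (p * x)) * y) + p * p * (q * q) * (m′ * x * y)
        split = ℕ-solve-∀
        merge : ∀ p q h g y → q * q * (h * g * (q * (q * y))) + p * p * (q * q) * (h * g * y)
                            ≡ (q * q + p * p) * h * g * (q * (q * y))
        merge = ℕ-solve-∀

majorant-vanishes : ∀ a d k → a + a + d < k → majorant a d k ≡ 0
majorant-vanishes zero    d k                   d<k = k>n⇒nCk≡0 d<k
majorant-vanishes (suc a) d (suc zero)    (s≤s ())
majorant-vanishes (suc a) d (suc (suc j)) lt     =
  cong₂ _+_ (majorant-vanishes a d (suc (suc j)) (ℕ.m<n⇒m<1+n (ℕ.m<n⇒m<1+n E<j)))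
            (majorant-vanishes a d j E<j)
  where
    E<j : a + a + d < j
    E<j = s<s⁻¹ (s<s⁻¹ (subst (_< suc (suc j)) (cong (_+ d) (ℕ.+-suc (suc a) a)) lt))

-- Powers of 1 + y/z

[z+y]*[z∸[y+c]]≤z*[z∸c] : ∀ z y c → (z + y) * (z ∸ (y + c)) ≤ z * (z ∸ c)
[z+y]*[z∸[y+c]]≤z*[z∸c] z y c with y + c ℕ.≤? z
... | no y+c≰z rewrite ℕ.m≤n⇒m∸n≡0 (ℕ.<⇒≤ (ℕ.≰⇒> y+c≰z)) | ℕ.*-zeroʳ (z + y) = z≤n
... | yes y+c≤z with z ∸ (y + c) | ℕ.m+[n∸m]≡n y+c≤z
...   | t | refl = begin
  (y + c + t + y) * t                 ≤⟨ ℕ.m≤m+n ((y + c + t + y) * t) (y * (y + c)) ⟩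
  (y + c + t + y) * t + y * (y + c)   ≡⟨ expand y c t ⟩
  (y + c + t) * (y + t)               ≡⟨ cong (_*_ (y + c + t)) (ℕ.m+n∸n≡m (y + t) c) ⟨
  (y + c + t) * (y + t + c ∸ c)       ≡⟨ cong (λ x → (y + c + t) * (x ∸ c)) (swap y c t) ⟨
  (y + c + t) * (y + c + t ∸ c)       ∎
  where
    open ℕ.≤-Reasoning
    swap : ∀ y c t → y + c + t ≡ y + t + c
    swap = ℕ-solve-∀
    expand : ∀ y c t → (y + c + t + y) * t + y * (y + c) ≡ (y + c + t) * (y + t)
    expand = ℕ-solve-∀

-- Bernoulli's inequality (1 + x)^b (1 - b x) ≤ 1, cleared of denominators.
bernoulli : ∀ z y b → (z + y) ^ b * (z ∸ b * y) ≤ z ^ suc b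
bernoulli z y zero    = ℕ.≤-reflexive (trans (ℕ.+-identityʳ z) (sym (ℕ.*-identityʳ z)))
bernoulli z y (suc b) = begin
  (z + y) * (z + y) ^ b * (z ∸ (y + b * y))   ≡⟨ rotate (z + y) ((z + y) ^ b) (z ∸ (y + b * y)) ⟩
  (z + y) ^ b * ((z + y) * (z ∸ (y + b * y))) ≤⟨ ℕ.*-monoʳ-≤ ((z + y) ^ b) ([z+y]*[z∸[y+c]]≤z*[z∸c] z y (b * y)) ⟩
  (z + y) ^ b * (z * (z ∸ b * y))             ≡⟨ swap ((z + y) ^ b) z (z ∸ b * y) ⟩
  z * ((z + y) ^ b * (z ∸ b * y))             ≤⟨ ℕ.*-monoʳ-≤ z (bernoulli z y b) ⟩
  z * z ^ suc b                               ∎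
  where
    open ℕ.≤-Reasoning
    rotate : ∀ a x w → a * x * w ≡ x * (a * w)
    rotate = ℕ-solve-∀
    swap : ∀ p a x → p * (a * x) ≡ a * (p * x)
    swap = ℕ-solve-∀

z≤2*[z∸x] : ∀ {z x} → 2 * x ≤ z → z ≤ 2 * (z ∸ x)
z≤2*[z∸x] {z} {x} 2x≤z with z ∸ x | ℕ.m+[n∸m]≡n (ℕ.≤-trans (ℕ.m≤m+n x (x + 0)) 2x≤z)
... | t | refl = begin
  x + t        ≤⟨ ℕ.+-monoˡ-≤ t (ℕ.+-cancelˡ-≤ x x t (ℕ.≤-trans (ℕ.≤-reflexive (cong (_+_ x) (sym (ℕ.+-identityʳ x)))) 2x≤z)) ⟩
  t + t        ≡⟨ cong (_+_ t) (ℕ.+-identityʳ t) ⟨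
  2 * t        ∎
  where open ℕ.≤-Reasoning

[z+y]^b≤2*z^b : ∀ {z y b} → 0 < z → 2 * (b * y) ≤ z → (z + y) ^ b ≤ 2 * z ^ b
[z+y]^b≤2*z^b {z@(suc _)} {y} {b} _ 2by≤z = ℕ.*-cancelˡ-≤ z (begin
  z * (z + y) ^ b                  ≤⟨ ℕ.*-monoˡ-≤ ((z + y) ^ b) (z≤2*[z∸x] {z} {b * y} 2by≤z) ⟩
  2 * (z ∸ b * y) * (z + y) ^ b    ≡⟨ rotate 2 (z ∸ b * y) ((z + y) ^ b) ⟩
  2 * ((z + y) ^ b * (z ∸ b * y))  ≤⟨ ℕ.*-monoʳ-≤ 2 (bernoulli z y b) ⟩
  2 * (z * z ^ b)                  ≡⟨ swap 2 z (z ^ b) ⟩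
  z * (2 * z ^ b)                  ∎)
  where
    open ℕ.≤-Reasoning
    rotate : ∀ a x w → a * x * w ≡ a * (w * x)
    rotate = ℕ-solve-∀
    swap : ∀ a x w → a * (x * w) ≡ x * (a * w)
    swap = ℕ-solve-∀

[z+y]^a≤2^c*z^a : ∀ {z y b} → 0 < z → 2 * (b * y) ≤ z → ∀ c a → a ≤ c * b → (z + y) ^ a ≤ 2 ^ c * z ^ a
[z+y]^a≤2^c*z^a 0<z 2by≤z zero    zero z≤n = ℕ.≤-refl
[z+y]^a≤2^c*z^a {z} {y} {b} 0<z 2by≤z (suc c) a a≤ =
  subst (λ t → (z + y) ^ t ≤ 2 ^ suc c * z ^ t) (ℕ.m⊓n+n∸m≡n b a) (begin
    (z + y) ^ (b ⊓ a + (a ∸ b))                 ≡⟨ ℕ.^-distribˡ-+-* (z + y) (b ⊓ a) (a ∸ b) ⟩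
    (z + y) ^ (b ⊓ a) * (z + y) ^ (a ∸ b)       ≤⟨ ℕ.*-mono-≤ head tail ⟩
    2 * z ^ (b ⊓ a) * (2 ^ c * z ^ (a ∸ b))     ≡⟨ interchange 2 (z ^ (b ⊓ a)) (2 ^ c) (z ^ (a ∸ b)) ⟩
    2 * 2 ^ c * (z ^ (b ⊓ a) * z ^ (a ∸ b))     ≡⟨ cong (2 ^ suc c *_) (ℕ.^-distribˡ-+-* z (b ⊓ a) (a ∸ b)) ⟨
    2 ^ suc c * z ^ (b ⊓ a + (a ∸ b))           ∎)
  where
    open ℕ.≤-Reasoning
    head : (z + y) ^ (b ⊓ a) ≤ 2 * z ^ (b ⊓ a)
    head = [z+y]^b≤2*z^b {z} {y} {b ⊓ a} 0<z (ℕ.≤-trans (ℕ.*-monoʳ-≤ 2 (ℕ.*-monoˡ-≤ y (ℕ.m⊓n≤m b a))) 2by≤z)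
    tail : (z + y) ^ (a ∸ b) ≤ 2 ^ c * z ^ (a ∸ b)
    tail = [z+y]^a≤2^c*z^a 0<z 2by≤z c (a ∸ b) (ℕ.m≤n+o⇒m∸n≤o a b a≤)
    interchange : ∀ s x u w → s * x * (u * w) ≡ s * u * (x * w)
    interchange = ℕ-solve-∀

-- The exponent a is cut into blocks of size ⌊z / 2y⌋, on each of which (1 + y/z)^block ≤ 2.
[z+y]^a≤2^m*z^a : ∀ {z y} → 0 < z → 4 * y ≤ z → ∀ m a → 4 * (a * y) ≤ m * z → (z + y) ^ a ≤ 2 ^ m * z ^ a
[z+y]^a≤2^m*z^a {z} {zero} _ _ m a _ = begin
  (z + 0) ^ a     ≡⟨ cong (_^ a) (ℕ.+-identityʳ z) ⟩
  z ^ a           ≤⟨ ℕ.m≤n*m (z ^ a) (2 ^ m) {{ℕ.m^n≢0 2 m}} ⟩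
  2 ^ m * z ^ a   ∎
  where open ℕ.≤-Reasoning
[z+y]^a≤2^m*z^a {z} {y@(suc _)} 0<z 4y≤z m a 4ay≤mz = [z+y]^a≤2^c*z^a 0<z 2by≤z m a a≤mb
  where
    open ℕ.≤-Reasoning
    b = z / (2 * y)
    2by≤z : 2 * (b * y) ≤ z
    2by≤z = ℕ.≤-trans (ℕ.≤-reflexive (reorder b y)) (m/n*n≤m z (2 * y))
      where
        reorder : ∀ b y → 2 * (b * y) ≡ b * (2 * y)
        reorder = ℕ-solve-∀
    z<4by : z < 4 * (b * y)
    z<4by = ℕ.+-cancelˡ-< z z (4 * (b * y)) (begin-strict
      z + z                            ≡⟨ cong (_+_ z) (ℕ.+-identityʳ z) ⟨
      2 * z                            <⟨ ℕ.*-monoʳ-< 2 z<d+bd ⟩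
      2 * (2 * y + b * (2 * y))        ≡⟨ expand y b ⟩
      4 * y + 4 * (b * y)              ≤⟨ ℕ.+-monoˡ-≤ (4 * (b * y)) 4y≤z ⟩
      z + 4 * (b * y)                  ∎)
      where
        z<d+bd : z < 2 * y + b * (2 * y)
        z<d+bd = subst (_< 2 * y + b * (2 * y)) (sym (m≡m%n+[m/n]*n z (2 * y)))
                       (ℕ.+-monoˡ-< (b * (2 * y)) (m%n<n z (2 * y)))
        expand : ∀ y b → 2 * (2 * y + b * (2 * y)) ≡ 4 * y + 4 * (b * y)
        expand = ℕ-solve-∀
    a≤mb : a ≤ m * b
    a≤mb = ℕ.*-cancelʳ-≤ a (m * b) (4 * y) (begin
      a * (4 * y)            ≡⟨ swap a y ⟩
      4 * (a * y)            ≤⟨ 4ay≤mz ⟩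
      m * z                  ≤⟨ ℕ.*-monoʳ-≤ m (ℕ.<⇒≤ z<4by) ⟩
      m * (4 * (b * y))      ≡⟨ regroup m b y ⟩
      m * b * (4 * y)        ∎)
      where
        swap : ∀ a y → a * (4 * y) ≡ 4 * (a * y)
        swap = ℕ-solve-∀
        regroup : ∀ m b y → m * (4 * (b * y)) ≡ m * b * (4 * y)
        regroup = ℕ-solve-∀

^-distribʳ-* : ∀ m n o → (m * n) ^ o ≡ m ^ o * n ^ o
^-distribʳ-* m n zero    = refl
^-distribʳ-* m n (suc o) = trans (cong (m * n *_) (^-distribʳ-* m n o)) (interchange m n (m ^ o) (n ^ o))
  where
    interchange : ∀ m n x y → m * n * (x * y) ≡ m * x * (n * y)
    interchange = ℕ-solve-∀

[x^k]^2≡[x*x]^k : ∀ x k → (x ^ k) ^ 2 ≡ (x * x) ^ k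
[x^k]^2≡[x*x]^k x k = trans (cong (x ^ k *_) (ℕ.*-identityʳ (x ^ k))) (sym (^-distribʳ-* x x k))

floor-sqrt : ∀ N → ∃ λ r → r * r ≤ N × N < suc r * suc r
floor-sqrt zero = 0 , z≤n , s≤s z≤n
floor-sqrt (suc N) with floor-sqrt N
... | r , r²≤N , N<[1+r]² with suc r * suc r ℕ.≤? suc N
...   | yes [1+r]²≤1+N = suc r , [1+r]²≤1+N ,
                         ℕ.≤-<-trans N<[1+r]² (ℕ.*-mono-< (ℕ.n<1+n (suc r)) (ℕ.n<1+n (suc r)))
...   | no  [1+r]²≰1+N = r , ℕ.m≤n⇒m≤1+n r²≤N , ℕ.≰⇒> [1+r]²≰1+N

-- Evaluating the generating function at z = k / q.
majorant*k^k≤4096^k*q^k : ∀ {k a e q} → 1 ≤ k → 4 * k ≤ q → e ≤ q → (a + a + e) * k ≤ 4 * (q * q) →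
                         majorant a e k * k ^ k ≤ 4096 ^ k * q ^ k
majorant*k^k≤4096^k*q^k {k} {a} {e} {q} 1≤k 4k≤q e≤q nk≤4q² =
  ℕ.*-cancelʳ-≤ (majorant a e k * k ^ k) (4096 ^ k * q ^ k) (q ^ n) {{ℕ.m^n≢0 q n {{>-nonZero 0<q}}}} (begin
    majorant a e k * k ^ k * q ^ n                       ≤⟨ majorant-evaluation k q a e k ⟩
    (q * q + k * k) ^ a * (q + k) ^ e * q ^ k            ≤⟨ ℕ.*-monoˡ-≤ (q ^ k) (ℕ.*-mono-≤ first second) ⟩
    2 ^ (8 * k) * (q * q) ^ a * (2 ^ (4 * k) * q ^ e) * q ^ k
      ≡⟨ regroup (2 ^ (8 * k)) ((q * q) ^ a) (2 ^ (4 * k)) (q ^ e) (q ^ k) ⟩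
    2 ^ (8 * k) * 2 ^ (4 * k) * q ^ k * ((q * q) ^ a * q ^ e)
      ≡⟨ cong₂ (λ x y → x * q ^ k * y) 2^[8k]*2^[4k]≡4096^k [q*q]^a*q^e≡q^n ⟩
    4096 ^ k * q ^ k * q ^ n                             ∎)
  where
    open ℕ.≤-Reasoning
    n = a + a + e
    0<q : 0 < q
    0<q = ℕ.≤-trans (ℕ.≤-trans 1≤k (ℕ.m≤n*m k 4)) 4k≤q
    4k²≤q² : 4 * (k * k) ≤ q * q
    4k²≤q² = ℕ.≤-trans (ℕ.≤-trans (ℕ.m≤m+n (4 * (k * k)) (12 * (k * k))) (ℕ.≤-reflexive (square k)))
                       (ℕ.*-mono-≤ 4k≤q 4k≤q)
      where
        square : ∀ k → 4 * (k * k) + 12 * (k * k) ≡ 4 * k * (4 * k)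
        square = ℕ-solve-∀
    first : (q * q + k * k) ^ a ≤ 2 ^ (8 * k) * (q * q) ^ a
    first = [z+y]^a≤2^m*z^a (ℕ.*-mono-≤ 0<q 0<q) 4k²≤q² (8 * k) a (begin
      4 * (a * (k * k))       ≡⟨ twice k a ⟩
      2 * k * ((a + a) * k)   ≤⟨ ℕ.*-monoʳ-≤ (2 * k) (ℕ.*-monoˡ-≤ k (ℕ.m≤m+n (a + a) e)) ⟩
      2 * k * (n * k)         ≤⟨ ℕ.*-monoʳ-≤ (2 * k) nk≤4q² ⟩
      2 * k * (4 * (q * q))   ≡⟨ collect k (q * q) ⟩
      8 * k * (q * q)         ∎)
      where
        twice : ∀ k a → 4 * (a * (k * k)) ≡ 2 * k * ((a + a) * k)
        twice = ℕ-solve-∀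
        collect : ∀ k x → 2 * k * (4 * x) ≡ 8 * k * x
        collect = ℕ-solve-∀
    second : (q + k) ^ e ≤ 2 ^ (4 * k) * q ^ e
    second = [z+y]^a≤2^m*z^a 0<q 4k≤q (4 * k) e
               (ℕ.≤-trans (ℕ.≤-reflexive (swap e k)) (ℕ.*-monoʳ-≤ (4 * k) e≤q))
      where
        swap : ∀ e k → 4 * (e * k) ≡ 4 * k * e
        swap = ℕ-solve-∀
    regroup : ∀ s x t y u → s * x * (t * y) * u ≡ s * t * u * (x * y)
    regroup = ℕ-solve-∀
    2^[8k]*2^[4k]≡4096^k : 2 ^ (8 * k) * 2 ^ (4 * k) ≡ 4096 ^ k
    2^[8k]*2^[4k]≡4096^k = begin-equality
      2 ^ (8 * k) * 2 ^ (4 * k)   ≡⟨ ℕ.^-distribˡ-+-* 2 (8 * k) (4 * k) ⟨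
      2 ^ (8 * k + 4 * k)         ≡⟨ cong (2 ^_) (sum k) ⟩
      2 ^ (12 * k)                ≡⟨ ℕ.^-*-assoc 2 12 k ⟨
      4096 ^ k                    ∎
      where
        sum : ∀ k → 8 * k + 4 * k ≡ 12 * k
        sum = ℕ-solve-∀
    [q*q]^a*q^e≡q^n : (q * q) ^ a * q ^ e ≡ q ^ n
    [q*q]^a*q^e≡q^n = begin-equality
      (q * q) ^ a * q ^ e       ≡⟨ cong (_* q ^ e) (^-distribʳ-* q q a) ⟩
      q ^ a * q ^ a * q ^ e     ≡⟨ cong (_* q ^ e) (ℕ.^-distribˡ-+-* q a a) ⟨
      q ^ (a + a) * q ^ e       ≡⟨ ℕ.^-distribˡ-+-* q (a + a) e ⟨
      q ^ n                     ∎

scale : ∀ {n k} e → 1 ≤ k → k ≤ n → ∃ λ q →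
  4 * k ≤ q × e ≤ q × n * k ≤ 4 * (q * q) × (q * q ≤ 16 * (n * k) ⊎ q ≡ e)
scale {n} {k} e 1≤k k≤n with floor-sqrt (n * k)
... | r , r²≤nk , nk<[1+r]² = e ⊔ t , 4k≤q , ℕ.m≤m⊔n e t , nk≤4q² , small-or-e
  where
    open ℕ.≤-Reasoning
    t = r ⊔ 4 * k
    q = e ⊔ t
    4k≤q : 4 * k ≤ q
    4k≤q = ℕ.≤-trans (ℕ.m≤n⊔m r (4 * k)) (ℕ.m≤n⊔m e t)
    1+r≤q+q : suc r ≤ q + q
    1+r≤q+q = ℕ.+-mono-≤ (ℕ.≤-trans (ℕ.≤-trans 1≤k (ℕ.m≤n*m k 4)) 4k≤q)
                         (ℕ.≤-trans (ℕ.m≤m⊔n r (4 * k)) (ℕ.m≤n⊔m e t))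
    nk≤4q² : n * k ≤ 4 * (q * q)
    nk≤4q² = begin
      n * k              ≤⟨ ℕ.<⇒≤ nk<[1+r]² ⟩
      suc r * suc r      ≤⟨ ℕ.*-mono-≤ 1+r≤q+q 1+r≤q+q ⟩
      (q + q) * (q + q)  ≡⟨ double q ⟩
      4 * (q * q)        ∎
      where
        double : ∀ q → (q + q) * (q + q) ≡ 4 * (q * q)
        double = ℕ-solve-∀
    t²≤16nk : t * t ≤ 16 * (n * k)
    t²≤16nk with ℕ.⊔-sel r (4 * k)
    ... | inj₁ t≡r rewrite t≡r = ℕ.≤-trans r²≤nk (ℕ.m≤n*m (n * k) 16)
    ... | inj₂ t≡4k rewrite t≡4k = begin
      4 * k * (4 * k)    ≡⟨ square k ⟩
      16 * (k * k)       ≤⟨ ℕ.*-monoʳ-≤ 16 (ℕ.*-monoˡ-≤ k k≤n) ⟩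
      16 * (n * k)       ∎
      where
        square : ∀ k → 4 * k * (4 * k) ≡ 16 * (k * k)
        square = ℕ-solve-∀
    small-or-e : q * q ≤ 16 * (n * k) ⊎ q ≡ e
    small-or-e with ℕ.⊔-sel e t
    ... | inj₁ q≡e = inj₂ q≡e
    ... | inj₂ q≡t rewrite q≡t = inj₁ t²≤16nk

[c^k*q^k]^2≤[c*c*d]^k*[n^k*k^k] : ∀ c d q n k → q * q ≤ d * (n * k) →
  (c ^ k * q ^ k) ^ 2 ≤ (c * c * d) ^ k * (n ^ k * k ^ k)
[c^k*q^k]^2≤[c*c*d]^k*[n^k*k^k] c d q n k q²≤dnk = begin
  (c ^ k * q ^ k) ^ 2              ≡⟨ cong (_^ 2) (^-distribʳ-* c q k) ⟨
  ((c * q) ^ k) ^ 2                ≡⟨ [x^k]^2≡[x*x]^k (c * q) k ⟩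
  (c * q * (c * q)) ^ k            ≡⟨ cong (_^ k) (interchange c q) ⟩
  (c * c * (q * q)) ^ k            ≤⟨ ℕ.^-monoˡ-≤ k (ℕ.*-monoʳ-≤ (c * c) q²≤dnk) ⟩
  (c * c * (d * (n * k))) ^ k      ≡⟨ cong (_^ k) (ℕ.*-assoc (c * c) d (n * k)) ⟨
  (c * c * d * (n * k)) ^ k        ≡⟨ ^-distribʳ-* (c * c * d) (n * k) k ⟩
  (c * c * d) ^ k * (n * k) ^ k    ≡⟨ cong ((c * c * d) ^ k *_) (^-distribʳ-* n k k) ⟩
  (c * c * d) ^ k * (n ^ k * k ^ k) ∎
  where
    open ℕ.≤-Reasoning
    interchange : ∀ c q → c * q * (c * q) ≡ c * c * (q * q)
    interchange = ℕ-solve-∀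

2≤m≤1+2n⇒m≤4n : ∀ {m n} → 2 ≤ m → m ≤ 1 + 2 * n → m ≤ 4 * n
2≤m≤1+2n⇒m≤4n {m} {zero}  2≤m m≤1 with ℕ.≤-trans 2≤m m≤1
... | s≤s ()
2≤m≤1+2n⇒m≤4n {m} {suc n} 2≤m m≤ =
  ℕ.≤-trans m≤ (ℕ.≤-trans (ℕ.+-monoˡ-≤ (2 * suc n) (s≤s z≤n)) (ℕ.≤-reflexive (double (suc n))))
  where
    double : ∀ n → 2 * n + 2 * n ≡ 4 * n
    double = ℕ-solve-∀

[x∸y]^2≤z : ∀ {x y z} → x ≤ y ⊎ x ^ 2 ≤ z → (x ∸ y) ^ 2 ≤ z
[x∸y]^2≤z (inj₁ x≤y) rewrite ℕ.m≤n⇒m∸n≡0 x≤y = z≤n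
[x∸y]^2≤z {x} {y} (inj₂ x²≤z) = ℕ.≤-trans (ℕ.^-monoˡ-≤ 2 (ℕ.m∸n≤m x y)) x²≤z

majorant-bound : ∀ {n k a e K S} → 1 ≤ k → n ≡ a + a + e → e ≤ 1 + 2 * S → K ≤ majorant a e k →
  K * k ^ k ≤ 16384 ^ k * S ^ k ⊎ (K * k ^ k) ^ 2 ≤ (16384 ^ k) ^ 2 * (n ^ k * k ^ k)
majorant-bound {n} {k} {a} {e} {K} {S} 1≤k refl e≤ K≤ with k ℕ.≤? n
... | no k≰n rewrite ℕ.n≤0⇒n≡0 (ℕ.≤-trans K≤ (ℕ.≤-reflexive (majorant-vanishes a e k (ℕ.≰⇒> k≰n)))) = inj₁ z≤n
... | yes k≤n with scale e 1≤k k≤n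
...   | q , 4k≤q , e≤q , nk≤4q² , small-or-e = bound small-or-e
  where
    open ℕ.≤-Reasoning
    Kk^k≤4096^kq^k : K * k ^ k ≤ 4096 ^ k * q ^ k
    Kk^k≤4096^kq^k =
      ℕ.≤-trans (ℕ.*-monoˡ-≤ (k ^ k) K≤) (majorant*k^k≤4096^k*q^k {k} {a} 1≤k 4k≤q e≤q nk≤4q²)
    bound : q * q ≤ 16 * (n * k) ⊎ q ≡ e →
            K * k ^ k ≤ 16384 ^ k * S ^ k ⊎ (K * k ^ k) ^ 2 ≤ (16384 ^ k) ^ 2 * (n ^ k * k ^ k)
    bound (inj₁ q²≤16nk) = inj₂ (begin
      (K * k ^ k) ^ 2                          ≤⟨ ℕ.^-monoˡ-≤ 2 Kk^k≤4096^kq^k ⟩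
      (4096 ^ k * q ^ k) ^ 2                   ≤⟨ [c^k*q^k]^2≤[c*c*d]^k*[n^k*k^k] 4096 16 q n k q²≤16nk ⟩
      (4096 * 4096 * 16) ^ k * (n ^ k * k ^ k) ≡⟨ cong (_* (n ^ k * k ^ k)) ([x^k]^2≡[x*x]^k 16384 k) ⟨
      (16384 ^ k) ^ 2 * (n ^ k * k ^ k)        ∎)
    bound (inj₂ q≡e) = inj₁ (begin
      K * k ^ k                   ≤⟨ Kk^k≤4096^kq^k ⟩
      4096 ^ k * q ^ k            ≡⟨ cong (λ x → 4096 ^ k * x ^ k) q≡e ⟩
      4096 ^ k * e ^ k            ≤⟨ ℕ.*-monoʳ-≤ (4096 ^ k) (ℕ.^-monoˡ-≤ k (2≤m≤1+2n⇒m≤4n {e} {S} 2≤e e≤)) ⟩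
      4096 ^ k * (4 * S) ^ k      ≡⟨ cong (4096 ^ k *_) (^-distribʳ-* 4 S k) ⟩
      4096 ^ k * (4 ^ k * S ^ k)  ≡⟨ ℕ.*-assoc (4096 ^ k) (4 ^ k) (S ^ k) ⟨
      4096 ^ k * 4 ^ k * S ^ k    ≡⟨ cong (_* S ^ k) (^-distribʳ-* 4096 4 k) ⟨
      16384 ^ k * S ^ k           ∎)
      where
        2≤e : 2 ≤ e
        2≤e = ℕ.≤-trans (ℕ.≤-trans (s≤s (s≤s z≤n)) (ℕ.*-monoʳ-≤ 4 1≤k)) (subst (4 * k ≤_) q≡e 4k≤q)

∣w-u∣≤ρ+2∣s∣ : ∀ {w u h ρ} s → w + u ≡ ρ + h * 2 → + w ≡ + h ℤ.+ s → ∣ + w ℤ.- + u ∣ ≤ ρ + 2 * ∣ s ∣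
∣w-u∣≤ρ+2∣s∣ {w} {u} {h} {ρ} s w+u≡ w≡ = begin
  ∣ + w ℤ.- + u ∣                 ≡⟨ cong ∣_∣ difference ⟩
  ∣ s ℤ.* + 2 ℤ.- + ρ ∣           ≤⟨ ℤ.∣i-j∣≤∣i∣+∣j∣ (s ℤ.* + 2) (+ ρ) ⟩
  ∣ s ℤ.* + 2 ∣ + ρ               ≡⟨ cong (_+ ρ) (ℤ.abs-* s (+ 2)) ⟩
  ∣ s ∣ * 2 + ρ                   ≡⟨ reorder ∣ s ∣ ρ ⟩
  ρ + 2 * ∣ s ∣                   ∎
  where
    open ℕ.≤-Reasoning
    reorder : ∀ a r → a * 2 + r ≡ r + 2 * a
    reorder = ℕ-solve-∀
    sum≡ : + w ℤ.+ + u ≡ + ρ ℤ.+ + h ℤ.* + 2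
    sum≡ = trans (sym (ℤ.pos-+ w u)) (trans (cong +_ w+u≡) (trans (ℤ.pos-+ ρ (h * 2)) (cong (ℤ._+_ (+ ρ)) (ℤ.pos-* h 2))))
    difference : + w ℤ.- + u ≡ s ℤ.* + 2 ℤ.- + ρ
    difference = trans (double-minus-sum (+ w) (+ u))
                (trans (cong₂ (λ x y → (x ℤ.+ x) ℤ.- y) w≡ sum≡) (collect (+ h) s (+ ρ)))
      where
        double-minus-sum : ∀ x y → x ℤ.- y ≡ (x ℤ.+ x) ℤ.- (x ℤ.+ y)
        double-minus-sum = ℤ-solve-∀
        collect : ∀ x t r → ((x ℤ.+ t) ℤ.+ (x ℤ.+ t)) ℤ.- (r ℤ.+ x ℤ.* + 2) ≡ t ℤ.* + 2 ℤ.- r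
        collect = ℤ-solve-∀

∣kravchuk∣≤majorant : ∀ {n w} k s → w ≤ n → + w ≡ + (n / 2) ℤ.+ s →
  ∃₂ λ a e → n ≡ a + a + e × e ≤ 1 + 2 * ∣ s ∣ × ∣ kravchuk n w k ∣ ≤ majorant a e k
∣kravchuk∣≤majorant {n} {w} k s w≤n w≡ with ∣kravchukCoeff∣≤majorant w (n ∸ w) k
... | a , e , w+u≡ , ∣w-u∣≡e , ∣P∣≤ =
  a , e , trans (sym w+u≡n) w+u≡ , e≤ , subst (λ x → ∣ x ∣ ≤ majorant a e k) (sym (kravchuk≡kravchukCoeff k w≤n)) ∣P∣≤
  where
    w+u≡n : w + (n ∸ w) ≡ n
    w+u≡n = ℕ.m+[n∸m]≡n w≤n
    e≤ : e ≤ 1 + 2 * ∣ s ∣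
    e≤ = subst (_≤ 1 + 2 * ∣ s ∣) ∣w-u∣≡e
           (ℕ.≤-trans (∣w-u∣≤ρ+2∣s∣ s (trans w+u≡n (m≡m%n+[m/n]*n n 2)) w≡)
                      (ℕ.+-monoˡ-≤ (2 * ∣ s ∣) (s≤s⁻¹ (m%n<n n 2))))

kravchuk-estimate : ∀ {n w} k s → 1 ≤ k → w ≤ n → + w ≡ + (n / 2) ℤ.+ s →
  ((∣ kravchuk n w k ∣ * k ^ k) ∸ 16384 ^ k * ∣ s ∣ ^ k) ^ 2 ≤ (16384 ^ k) ^ 2 * (n ^ k * k ^ k)
kravchuk-estimate k s 1≤k w≤n w≡ with ∣kravchuk∣≤majorant k s w≤n w≡
... | a , e , n≡ , e≤ , K≤ = [x∸y]^2≤z (majorant-bound {a = a} 1≤k n≡ e≤ K≤)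

claim4p7 : ∃ λ (C : ℕ) → 0 < C × ((n k : ℕ) (s : ℤ) → 1 ≤ n → 1 ≤ k
    → + 0 ≤ℤ (+ (n / 2)) +ℤ s → (+ (n / 2)) +ℤ s ≤ℤ + n
    → ((∣ kravchuk n (∣ (+ (n / 2)) +ℤ s ∣) k ∣ * k ^ k) ∸ C ^ k * ∣ s ∣ ^ k) ^ 2
    ≤ (C ^ k) ^ 2 * (n ^ k * k ^ k))
claim4p7 = 16384 , s≤s z≤n , λ n k s _ 1≤k 0≤w w≤n →
  let +∣w∣≡w = ℤ.0≤i⇒+∣i∣≡i 0≤w in
  kravchuk-estimate k s 1≤k (ℤ.drop‿+≤+ (subst (_≤ℤ + n) (sym +∣w∣≡w) w≤n)) +∣w∣≡w
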